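{- Let $q$ be a prime power, let $G$ be a finite group with order coprime to $q$, let $V$ be a finite-dimensional vector space over $\mathbb{F}_q$, and let $(\rho, V)$ be a representation of $G$. Let $V = \bigoplus_i W_i$ be a decomposition of $V$ into subrepresentations ($G$-invariant subspaces). Then $$\max_i \{h_{G,\rho}(W_i)\} \leq h_{G,\rho}(V) \leq \min\Big\{\sum_i h_{G,\rho}(W_i),\ \lfloor \log_q(|G|) \rfloor\Big\}.$$
   Context: For a representation $\rho: G \to \mathrm{GL}(V)$ of a group $G$ on a vector space $V$, a subspace $U \le V$ is $(G,\rho)$-covering if $\bigcup_{g\in G} \rho(g)(U) = V$, where $\rho(g)(U)=\{\rho(g)(u): u \in U\}$. $h_{G,\rho}(V)$ denotes the maximum possible codimension of a $(G,\rho)$-covering subspace of $V$; for a $G$-invariant subspace $W$, $h_{G,\rho}(W)$ is defined in the same way using the restricted action on $W$. -}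

module Defs where

open import Level using (Level; _⊔_; Lift) renaming (suc to lsuc)
open import Data.Nat using (ℕ; zero; suc; _∸_; _^_; _≤_) renaming (_+_ to _+ℕ_)
open import Data.Nat.Primality using (Prime)
open import Data.Fin using (Fin) renaming (zero to fzero; suc to fsuc)
open import Data.Product using (Σ; ∃; _×_; _,_)
open import Data.Unit.Polymorphic using (⊤)
open import Relation.Nullary using (¬_)
open import Relation.Binary.PropositionalEquality using (_≡_)
open import Algebra.Bundles using (CommutativeRing; Group)

record Field (c ℓ : Level) : Set (lsuc (c ⊔ ℓ)) where
  field
    commutativeRing : CommutativeRing c ℓ
  open CommutativeRing commutativeRing public
  field
    1≉0 : ¬ (1# ≈ 0#)
    inverse : ∀ x → ¬ (x ≈ 0#) → ∃ λ y → (x * y) ≈ 1#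

IsPrimePower : ℕ → Set
IsPrimePower q = Σ ℕ λ p → Σ ℕ λ e → Prime p × (q ≡ p ^ suc e)

HasCardinality : ∀ {c ℓ} → Field c ℓ → ℕ → Set (c ⊔ ℓ)
HasCardinality F q =
  Σ (Fin q → Carrier) λ enum →
    (∀ i j → enum i ≈ enum j → i ≡ j) × (∀ x → ∃ λ i → enum i ≈ x)
  where open Field F

HasOrder : ∀ {g ℓg} → Group g ℓg → ℕ → Set (g ⊔ ℓg)
HasOrder G m =
  Σ (Fin m → Carrier) λ enum →
    (∀ i j → enum i ≈ enum j → i ≡ j) × (∀ x → ∃ λ i → enum i ≈ x)
  where open Group G

sumℕ : ∀ {k} → (Fin k → ℕ) → ℕ
sumℕ {zero} h = 0
sumℕ {suc k} h = h fzero +ℕ sumℕ (λ i → h (fsuc i))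

module LinearAlgebra {c ℓ} (F : Field c ℓ) where
  open Field F

  Vecᶠ : ℕ → Set c
  Vecᶠ n = Fin n → Carrier

  _≋_ : ∀ {n} → Vecᶠ n → Vecᶠ n → Set ℓ
  u ≋ v = ∀ i → u i ≈ v i

  0ᵥ : ∀ {n} → Vecᶠ n
  0ᵥ i = 0#

  _+ᵥ_ : ∀ {n} → Vecᶠ n → Vecᶠ n → Vecᶠ n
  (u +ᵥ v) i = u i + v i

  _·_ : ∀ {n} → Carrier → Vecᶠ n → Vecᶠ n
  (a · v) i = a * v i

  sumᵥ : ∀ {n k} → (Fin k → Vecᶠ n) → Vecᶠ n
  sumᵥ {k = zero} w = 0ᵥ
  sumᵥ {k = suc k} w = w fzero +ᵥ sumᵥ (λ i → w (fsuc i))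

  lincomb : ∀ {n d} → (Fin d → Carrier) → (Fin d → Vecᶠ n) → Vecᶠ n
  lincomb a b = sumᵥ (λ i → a i · b i)

  record Subspace (n : ℕ) : Set (lsuc (c ⊔ ℓ)) where
    field
      mem : Vecᶠ n → Set (c ⊔ ℓ)
      mem-resp : ∀ {u v} → u ≋ v → mem u → mem v
      mem-0 : mem 0ᵥ
      mem-+ : ∀ {u v} → mem u → mem v → mem (u +ᵥ v)
      mem-· : ∀ a {v} → mem v → mem (a · v)
  open Subspace public

  whole : ∀ n → Subspace n
  whole n = record
    { mem = λ _ → ⊤ ; mem-resp = λ _ _ → _ ; mem-0 = _
    ; mem-+ = λ _ _ → _ ; mem-· = λ _ _ → _ }

  _⊆_ : ∀ {n} → Subspace n → Subspace n → Set (c ⊔ ℓ)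
  U ⊆ W = ∀ v → mem U v → mem W v

  LinearlyIndependent : ∀ {n d} → (Fin d → Vecᶠ n) → Set (c ⊔ ℓ)
  LinearlyIndependent b = ∀ a → lincomb a b ≋ 0ᵥ → ∀ i → a i ≈ 0#

  HasDim : ∀ {n} → Subspace n → ℕ → Set (c ⊔ ℓ)
  HasDim {n} U d =
    Σ (Fin d → Vecᶠ n) λ b →
      (∀ i → mem U (b i)) × LinearlyIndependent b ×
      (∀ v → mem U v → ∃ λ a → v ≋ lincomb a b)

  IsDirectSum : ∀ {n k} → (Fin k → Subspace n) → Set (c ⊔ ℓ)
  IsDirectSum {n} {k} W =
    (∀ v → ∃ λ (w : Fin k → Vecᶠ n) → (∀ i → mem (W i) (w i)) × (v ≋ sumᵥ w))
    × (∀ (w w' : Fin k → Vecᶠ n) → (∀ i → mem (W i) (w i)) → (∀ i → mem (W i) (w' i))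
         → sumᵥ w ≋ sumᵥ w' → ∀ i → w i ≋ w' i)

module Representations {c ℓ g ℓg} (F : Field c ℓ) (G : Group g ℓg) where
  open LinearAlgebra F
  module F = Field F
  module G = Group G

  record Representation (n : ℕ) : Set (c ⊔ ℓ ⊔ g ⊔ ℓg) where
    field
      act : G.Carrier → Vecᶠ n → Vecᶠ n
      act-cong : ∀ {x y u v} → x G.≈ y → u ≋ v → act x u ≋ act y v
      act-+ : ∀ x u v → act x (u +ᵥ v) ≋ (act x u +ᵥ act x v)
      act-· : ∀ x a v → act x (a · v) ≋ (a · act x v)
      act-ε : ∀ v → act G.ε v ≋ v
      act-∙ : ∀ x y v → act (x G.∙ y) v ≋ act x (act y v)
  open Representation public

  module _ {n : ℕ} (ρ : Representation n) where

    Invariant : Subspace n → Set (c ⊔ ℓ ⊔ g)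
    Invariant W = ∀ x v → mem W v → mem W (act ρ x v)

    Covering : Subspace n → Subspace n → Set (c ⊔ ℓ ⊔ g)
    Covering W U = U ⊆ W ×
      (∀ w → mem W w → Σ G.Carrier λ x → Σ (Vecᶠ n) λ u → mem U u × (act ρ x u ≋ w))

    CoveringOfCodim : Subspace n → Subspace n → ℕ → Set (c ⊔ ℓ ⊔ g)
    CoveringOfCodim W U h =
      Covering W U × Σ ℕ λ dW → Σ ℕ λ dU → HasDim W dW × HasDim U dU × (h ≡ dW ∸ dU)

    IsH : Subspace n → ℕ → Set (lsuc (c ⊔ ℓ) ⊔ g)
    IsH W h = (Σ (Subspace n) λ U → CoveringOfCodim W U h)
            × (∀ U h' → CoveringOfCodim W U h' → h' ≤ h)

-- Everything is a dimension count over F_q. If U covers W, picking for each w ∈ W some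
-- g ∈ G and u ∈ U with ρ(g)u = w is an injection W → G × U, so q^(dim W) ≤ |G| q^(dim U);
-- this gives q^h(V) ≤ |G|. If U covers V then, by invariance, U ∩ W_i covers W_i, and these
-- intersections form a direct sum inside U, so codim_V U ≤ Σ codim_{W_i} (U ∩ W_i) ≤ Σ h(W_i).
-- Conversely, replacing W_i in the decomposition by a covering subspace of W_i yields a
-- covering subspace of V of the same codimension, so h(W_i) ≤ h(V). The intersections have
-- bases because membership is decidable over a finite field, so independent families can be
-- extended greedily.

module Submission where

open import Defs
open import Level using (_⊔_) renaming (suc to lsuc)
open import Data.Nat as ℕ using (ℕ; zero; suc; _≤_; _<_; _^_; _∸_; z≤n; NonZero)
import Data.Nat.Properties as ℕP
open import Data.Nat.Coprimality using (Coprime)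
open import Data.Fin using (Fin; _↑ˡ_; _↑ʳ_; splitAt; combine; finToFun; funToFin)
  renaming (zero to fzero; suc to fsuc)
import Data.Fin.Properties as FinP
open import Data.Vec.Functional using (updateAt; _++_; _∷_)
open import Data.Vec.Functional.Properties using (updateAt-updates; updateAt-minimal)
open import Data.Product using (Σ; ∃; _×_; _,_; proj₁; proj₂)
open import Data.Sum using (inj₁; inj₂)
open import Data.Unit.Polymorphic using (tt)
open import Data.Empty using (⊥-elim)
open import Function using (_∘_; const)
open import Relation.Nullary using (¬_; Dec; yes; no; ¬?; _×-dec_)
open import Relation.Nullary.Decidable using (map′; decidable-stable)
open import Relation.Binary.PropositionalEquality as ≡ using (_≡_; _≢_)
open import Algebra.Bundles using (Group)
open import Relation.Binary.Bundles using (Setoid)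
import Algebra.Properties.CommutativeSemigroup as CommSemigroupProperties
import Algebra.Properties.Group as GroupProperties
import Algebra.Properties.Ring as RingProperties
import Relation.Binary.Reasoning.Setoid as SetoidReasoning
import Data.Vec.Functional.Relation.Binary.Equality.Setoid as PointwiseEquality

sumℕ-mono : ∀ {k} {a b : Fin k → ℕ} → (∀ j → a j ≤ b j) → sumℕ a ≤ sumℕ b
sumℕ-mono {zero} _ = z≤n
sumℕ-mono {suc k} a≤b = ℕP.+-mono-≤ (a≤b fzero) (sumℕ-mono (a≤b ∘ fsuc))

[x+y]∸[u+v]≤[x∸u]+[y∸v] : ∀ x y u v → (x ℕ.+ y) ∸ (u ℕ.+ v) ≤ (x ∸ u) ℕ.+ (y ∸ v)
[x+y]∸[u+v]≤[x∸u]+[y∸v] x y u v = ℕP.m≤n+o⇒m∸n≤o (x ℕ.+ y) (u ℕ.+ v) (begin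
  x ℕ.+ y                                ≤⟨ ℕP.+-mono-≤ (ℕP.m≤n+m∸n x u) (ℕP.m≤n+m∸n y v) ⟩
  (u ℕ.+ (x ∸ u)) ℕ.+ (v ℕ.+ (y ∸ v))    ≡⟨ interchange u (x ∸ u) v (y ∸ v) ⟩
  (u ℕ.+ v) ℕ.+ ((x ∸ u) ℕ.+ (y ∸ v))    ∎)
  where
  open ℕP.≤-Reasoning
  open CommSemigroupProperties ℕP.+-commutativeSemigroup using (interchange)

sumℕ-∸ : ∀ {k} (a b : Fin k → ℕ) → sumℕ a ∸ sumℕ b ≤ sumℕ (λ j → a j ∸ b j)
sumℕ-∸ {zero} _ _ = z≤n
sumℕ-∸ {suc k} a b = ℕP.≤-trans ([x+y]∸[u+v]≤[x∸u]+[y∸v] (a fzero) _ (b fzero) _)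
  (ℕP.+-monoʳ-≤ (a fzero ∸ b fzero) (sumℕ-∸ (a ∘ fsuc) (b ∘ fsuc)))

sumℕ-∸-updateAt : ∀ {a} {A : Set a} {k} (f : A → ℕ) (xs : Fin k → A) i y →
  sumℕ (f ∘ xs) ∸ sumℕ (f ∘ updateAt xs i (const y)) ≡ f (xs i) ∸ f y
sumℕ-∸-updateAt f xs fzero y =
  ≡.trans (≡.cong₂ _∸_ (ℕP.+-comm (f (xs fzero)) rest) (ℕP.+-comm (f y) rest))
          (ℕP.[m+n]∸[m+o]≡n∸o rest (f (xs fzero)) (f y))
  where rest = sumℕ (f ∘ xs ∘ fsuc)
sumℕ-∸-updateAt f xs (fsuc i) y =
  ≡.trans (ℕP.[m+n]∸[m+o]≡n∸o (f (xs fzero)) _ _) (sumℕ-∸-updateAt f (xs ∘ fsuc) i y)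

q^[a∸b]≤m : ∀ q .{{_ : NonZero q}} a b m → 1 ≤ m → q ^ a ≤ m ℕ.* q ^ b → q ^ (a ∸ b) ≤ m
q^[a∸b]≤m q a b m 1≤m q^a≤m*q^b with b ℕP.≤? a
... | yes b≤a = ℕP.*-cancelʳ-≤ (q ^ (a ∸ b)) m (q ^ b) {{ℕ.>-nonZero (ℕP.m^n>0 q b)}}
      (≡.subst (_≤ m ℕ.* q ^ b) q^a≡q^[a∸b]*q^b q^a≤m*q^b)
  where
  q^a≡q^[a∸b]*q^b : q ^ a ≡ q ^ (a ∸ b) ℕ.* q ^ b
  q^a≡q^[a∸b]*q^b =
    ≡.trans (≡.cong (q ^_) (≡.sym (ℕP.m∸n+n≡m b≤a))) (ℕP.^-distribˡ-+-* q (a ∸ b) b)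
... | no b≰a =
      ≡.subst (λ e → q ^ e ≤ m) (≡.sym (ℕP.m≤n⇒m∸n≡0 (ℕP.≰⇒≥ b≰a))) 1≤m

^-cancelˡ-≤ : ∀ q → 1 < q → ∀ d e → q ^ d ≤ q ^ e → d ≤ e
^-cancelˡ-≤ q 1<q d e q^d≤q^e =
  ℕP.≮⇒≥ (λ e<d → ℕP.<⇒≱ (ℕP.^-monoʳ-< q 1<q e<d) q^d≤q^e)

updateAt-elim : ∀ {a p} {A : Set a} {k} (P : Fin k → A → Set p) (xs : Fin k → A) i {y} →
  P i y → (∀ j → j ≢ i → P j (xs j)) → ∀ j → P j (updateAt xs i (const y) j)
updateAt-elim P xs i Py Pxs j with j FinP.≟ i
... | yes ≡.refl = ≡.subst (P j) (≡.sym (updateAt-updates j xs)) Py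
... | no j≢i = ≡.subst (P j) (≡.sym (updateAt-minimal j i xs j≢i)) (Pxs j j≢i)

++-↑ˡ : ∀ {a} {A : Set a} {m n} (u : Fin m → A) (v : Fin n → A) i → (u ++ v) (i ↑ˡ n) ≡ u i
++-↑ˡ {m = m} {n} u v i rewrite FinP.splitAt-↑ˡ m i n = ≡.refl

++-↑ʳ : ∀ {a} {A : Set a} {m n} (u : Fin m → A) (v : Fin n → A) i → (u ++ v) (m ↑ʳ i) ≡ v i
++-↑ʳ {m = m} {n} u v i rewrite FinP.splitAt-↑ʳ m n i = ≡.refl

concat : ∀ {a} {A : Set a} {k} {d : Fin k → ℕ} →
  ((j : Fin k) → Fin (d j) → A) → Fin (sumℕ d) → A
concat {k = zero} b ()
concat {k = suc k} b = b fzero ++ concat (b ∘ fsuc)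

concatIndex : ∀ {k} (d : Fin k → ℕ) (j : Fin k) → Fin (d j) → Fin (sumℕ d)
concatIndex d fzero i = i ↑ˡ sumℕ (d ∘ fsuc)
concatIndex d (fsuc j) i = d fzero ↑ʳ concatIndex (d ∘ fsuc) j i

concat-concatIndex : ∀ {a} {A : Set a} {k} {d : Fin k → ℕ} (b : (j : Fin k) → Fin (d j) → A) j i →
  concat b (concatIndex d j i) ≡ b j i
concat-concatIndex b fzero i = ++-↑ˡ (b fzero) (concat (b ∘ fsuc)) i
concat-concatIndex b (fsuc j) i =
  ≡.trans (++-↑ʳ (b fzero) (concat (b ∘ fsuc)) _) (concat-concatIndex (b ∘ fsuc) j i)

concatIndex-surjective : ∀ {k} (d : Fin k → ℕ) x → ∃ λ j → ∃ λ i → concatIndex d j i ≡ x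
concatIndex-surjective {zero} d ()
concatIndex-surjective {suc k} d x with splitAt (d fzero) x in eq
... | inj₁ i = fzero , i , FinP.splitAt⁻¹-↑ˡ eq
... | inj₂ y with concatIndex-surjective (d ∘ fsuc) y
...   | j , i , p = fsuc j , i , ≡.trans (≡.cong (d fzero ↑ʳ_) p) (FinP.splitAt⁻¹-↑ʳ eq)

funToFin-cong : ∀ {m n} {f g : Fin m → Fin n} → (∀ i → f i ≡ g i) → funToFin f ≡ funToFin g
funToFin-cong {zero} _ = ≡.refl
funToFin-cong {suc m} f≗g = ≡.cong₂ combine (f≗g fzero) (funToFin-cong (f≗g ∘ fsuc))

module Enumeration {a ℓ} (S : Setoid a ℓ) {q : ℕ}
  (enumeration : Σ (Fin q → Setoid.Carrier S) λ enum →
    (∀ i j → Setoid._≈_ S (enum i) (enum j) → i ≡ j) ×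
    (∀ x → ∃ λ i → Setoid._≈_ S (enum i) x)) where
  open Setoid S

  enum : Fin q → Carrier
  enum = proj₁ enumeration

  enum-injective : ∀ i j → enum i ≈ enum j → i ≡ j
  enum-injective = proj₁ (proj₂ enumeration)

  index : Carrier → Fin q
  index x = proj₁ (proj₂ (proj₂ enumeration) x)

  enum-index : ∀ x → enum (index x) ≈ x
  enum-index x = proj₂ (proj₂ (proj₂ enumeration) x)

  index-injective : ∀ {x y} → index x ≡ index y → x ≈ y
  index-injective {x} {y} eq =
    trans (sym (enum-index x)) (trans (reflexive (≡.cong enum eq)) (enum-index y))

  index-cong : ∀ {x y} → x ≈ y → index x ≡ index y
  index-cong {x} {y} x≈y =
    enum-injective _ _ (trans (enum-index x) (trans x≈y (sym (enum-index y))))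

module VectorSpace {c ℓ} (F : Field c ℓ) where
  open Field F
  open LinearAlgebra F
  open PointwiseEquality setoid public using (≋-refl; ≋-sym; ≋-trans; ≋-reflexive; ≋-setoid)
  open RingProperties ring using (-1*x≈-x)
  open GroupProperties +-group using (x∙y⁻¹≈ε⇒x≈y)
  open CommSemigroupProperties +-commutativeSemigroup using (interchange)

  module ≋-Reasoning (n : ℕ) = SetoidReasoning (≋-setoid n)

  a*x+l≈0⇒x≈-y*l : ∀ {a x l y} → a * x + l ≈ 0# → y * a ≈ 1# → x ≈ - y * l
  a*x+l≈0⇒x≈-y*l {a} {x} {l} {y} ax+l≈0 ya≈1 = begin
    x              ≈⟨ sym (*-identityˡ x) ⟩
    1# * x         ≈⟨ *-congʳ (sym ya≈1) ⟩
    (y * a) * x    ≈⟨ *-assoc y a x ⟩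
    y * (a * x)    ≈⟨ *-congˡ ax≈-l ⟩
    y * (- l)      ≈⟨ sym (RingProperties.-‿distribʳ-* ring y l) ⟩
    - (y * l)      ≈⟨ RingProperties.-‿distribˡ-* ring y l ⟩
    - y * l        ∎
    where
    open SetoidReasoning setoid
    ax≈-l : a * x ≈ - l
    ax≈-l = begin
      a * x                ≈⟨ sym (+-identityʳ _) ⟩
      a * x + 0#           ≈⟨ +-congˡ (sym (-‿inverseʳ l)) ⟩
      a * x + (l + - l)    ≈⟨ sym (+-assoc _ _ _) ⟩
      (a * x + l) + - l    ≈⟨ +-congʳ ax+l≈0 ⟩
      0# + - l             ≈⟨ +-identityˡ _ ⟩
      - l                  ∎

  +ᵥ-cong : ∀ {n} {u u' v v' : Vecᶠ n} → u ≋ u' → v ≋ v' → (u +ᵥ v) ≋ (u' +ᵥ v')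
  +ᵥ-cong u≋u' v≋v' i = +-cong (u≋u' i) (v≋v' i)

  ·-cong : ∀ {n a a'} {u u' : Vecᶠ n} → a ≈ a' → u ≋ u' → (a · u) ≋ (a' · u')
  ·-cong a≈a' u≋u' i = *-cong a≈a' (u≋u' i)

  sumᵥ-cong : ∀ {n k} {w w' : Fin k → Vecᶠ n} → (∀ j → w j ≋ w' j) → sumᵥ w ≋ sumᵥ w'
  sumᵥ-cong {k = zero} _ = ≋-refl
  sumᵥ-cong {k = suc k} w≋w' = +ᵥ-cong (w≋w' fzero) (sumᵥ-cong (w≋w' ∘ fsuc))

  sumᵥ-0ᵥ : ∀ {n k} {w : Fin k → Vecᶠ n} → (∀ j → w j ≋ 0ᵥ) → sumᵥ w ≋ 0ᵥ
  sumᵥ-0ᵥ {k = zero} _ = ≋-refl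
  sumᵥ-0ᵥ {k = suc k} w≋0 i =
    trans (+ᵥ-cong (w≋0 fzero) (sumᵥ-0ᵥ (w≋0 ∘ fsuc)) i) (+-identityˡ 0#)

  sumᵥ-+ᵥ : ∀ {n k} (w w' : Fin k → Vecᶠ n) →
    sumᵥ (λ j → w j +ᵥ w' j) ≋ (sumᵥ w +ᵥ sumᵥ w')
  sumᵥ-+ᵥ {k = zero} _ _ i = sym (+-identityˡ 0#)
  sumᵥ-+ᵥ {k = suc k} w w' i =
    trans (+-congˡ (sumᵥ-+ᵥ (w ∘ fsuc) (w' ∘ fsuc) i)) (interchange _ _ _ _)

  sumᵥ-↑ : ∀ {n} m m' (w : Fin (m ℕ.+ m') → Vecᶠ n) →
    sumᵥ w ≋ (sumᵥ (λ i → w (i ↑ˡ m')) +ᵥ sumᵥ (λ i → w (m ↑ʳ i)))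
  sumᵥ-↑ zero m' w i = sym (+-identityˡ _)
  sumᵥ-↑ (suc m) m' w i = trans (+-congˡ (sumᵥ-↑ m m' (w ∘ fsuc) i)) (sym (+-assoc _ _ _))

  sumᵥ-updateAt-0ᵥ : ∀ {n k} (j : Fin k) (v : Vecᶠ n) →
    sumᵥ (updateAt (λ _ → 0ᵥ) j (const v)) ≋ v
  sumᵥ-updateAt-0ᵥ {k = suc k} fzero v i =
    trans (+-congˡ (sumᵥ-0ᵥ {k = k} (λ _ → ≋-refl) i)) (+-identityʳ (v i))
  sumᵥ-updateAt-0ᵥ (fsuc j) v i = trans (+-congˡ (sumᵥ-updateAt-0ᵥ j v i)) (+-identityˡ (v i))

  record IsLinear {n m} (f : Vecᶠ n → Vecᶠ m) : Set (c ⊔ ℓ) where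
    field
      ≋-cong : ∀ {u v} → u ≋ v → f u ≋ f v
      +ᵥ-homo : ∀ u v → f (u +ᵥ v) ≋ (f u +ᵥ f v)
      ·-homo : ∀ a v → f (a · v) ≋ (a · f v)

    0ᵥ-homo : f 0ᵥ ≋ 0ᵥ
    0ᵥ-homo = begin
      f 0ᵥ           ≈⟨ ≋-cong (λ _ → sym (zeroˡ 0#)) ⟩
      f (0# · 0ᵥ)    ≈⟨ ·-homo 0# 0ᵥ ⟩
      0# · f 0ᵥ      ≈⟨ (λ i → zeroˡ (f 0ᵥ i)) ⟩
      0ᵥ             ∎
      where open ≋-Reasoning m

    sumᵥ-homo : ∀ {k} (w : Fin k → Vecᶠ n) → f (sumᵥ w) ≋ sumᵥ (f ∘ w)
    sumᵥ-homo {zero} w = 0ᵥ-homo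
    sumᵥ-homo {suc k} w = ≋-trans (+ᵥ-homo _ _) (+ᵥ-cong ≋-refl (sumᵥ-homo (w ∘ fsuc)))

  ·-linear : ∀ {n} a → IsLinear {n} (a ·_)
  ·-linear a = record
    { ≋-cong = λ u≋v i → *-congˡ (u≋v i)
    ; +ᵥ-homo = λ u v i → distribˡ a (u i) (v i)
    ; ·-homo = λ b v i →
        trans (sym (*-assoc a b (v i))) (trans (*-congʳ (*-comm a b)) (*-assoc b a (v i)))
    }

  lincomb-cong : ∀ {n d} {a a' : Fin d → Carrier} {b b' : Fin d → Vecᶠ n} →
    (∀ j → a j ≈ a' j) → (∀ j → b j ≋ b' j) → lincomb a b ≋ lincomb a' b'
  lincomb-cong a≈a' b≋b' = sumᵥ-cong (λ j → ·-cong (a≈a' j) (b≋b' j))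

  lincomb-0 : ∀ {n d} (b : Fin d → Vecᶠ n) → lincomb (λ _ → 0#) b ≋ 0ᵥ
  lincomb-0 b = sumᵥ-0ᵥ (λ j i → zeroˡ (b j i))

  lincomb-+ : ∀ {n d} (a a' : Fin d → Carrier) (b : Fin d → Vecᶠ n) →
    lincomb (λ j → a j + a' j) b ≋ (lincomb a b +ᵥ lincomb a' b)
  lincomb-+ a a' b = ≋-trans (sumᵥ-cong (λ j i → distribʳ (b j i) (a j) (a' j)))
                             (sumᵥ-+ᵥ (λ j → a j · b j) (λ j → a' j · b j))

  lincomb-* : ∀ {n d} s (a : Fin d → Carrier) (b : Fin d → Vecᶠ n) →
    lincomb (λ j → s * a j) b ≋ (s · lincomb a b)
  lincomb-* s a b = ≋-trans (sumᵥ-cong (λ j i → *-assoc s (a j) (b j i)))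
                            (≋-sym (IsLinear.sumᵥ-homo (·-linear s) (λ j → a j · b j)))

  lincomb-++ : ∀ {n m m'} (a : Fin (m ℕ.+ m') → Carrier) (u : Fin m → Vecᶠ n)
    (v : Fin m' → Vecᶠ n) →
    lincomb a (u ++ v) ≋ (lincomb (λ i → a (i ↑ˡ m')) u +ᵥ lincomb (λ i → a (m ↑ʳ i)) v)
  lincomb-++ {m = m} {m'} a u v = ≋-trans (sumᵥ-↑ m m' _)
    (+ᵥ-cong (sumᵥ-cong (λ i → ·-cong refl (≋-reflexive (++-↑ˡ u v i))))
             (sumᵥ-cong (λ i → ·-cong refl (≋-reflexive (++-↑ʳ u v i)))))

  lincomb-concat : ∀ {n k} {d : Fin k → ℕ} (a : Fin (sumℕ d) → Carrier)
    (b : (j : Fin k) → Fin (d j) → Vecᶠ n) →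
    lincomb a (concat b) ≋ sumᵥ (λ j → lincomb (λ i → a (concatIndex d j i)) (b j))
  lincomb-concat {k = zero} a b = ≋-refl
  lincomb-concat {k = suc k} {d} a b = ≋-trans (lincomb-++ a (b fzero) (concat (b ∘ fsuc)))
    (+ᵥ-cong ≋-refl (lincomb-concat (λ i → a (d fzero ↑ʳ i)) (b ∘ fsuc)))

  lincomb-injective : ∀ {n d} {b : Fin d → Vecᶠ n} → LinearlyIndependent b →
    ∀ {a a'} → lincomb a b ≋ lincomb a' b → ∀ j → a j ≈ a' j
  lincomb-injective {b = b} b-independent {a} {a'} ab≋a'b j =
    x∙y⁻¹≈ε⇒x≈y (a j) (a' j)
      (trans (+-congˡ (sym (-1*x≈-x (a' j)))) (b-independent _ difference≋0 j))
    where
    open ≋-Reasoning _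
    difference≋0 : lincomb (λ t → a t + - 1# * a' t) b ≋ 0ᵥ
    difference≋0 = begin
      lincomb (λ t → a t + - 1# * a' t) b
        ≈⟨ lincomb-+ a _ b ⟩
      lincomb a b +ᵥ lincomb (λ t → - 1# * a' t) b
        ≈⟨ +ᵥ-cong ab≋a'b (lincomb-* (- 1#) a' b) ⟩
      lincomb a' b +ᵥ ((- 1#) · lincomb a' b)
        ≈⟨ (λ i → trans (+-congˡ (-1*x≈-x _)) (-‿inverseʳ _)) ⟩
      0ᵥ
        ∎

  span : ∀ {n d} → (Fin d → Vecᶠ n) → Subspace n
  span b = record
    { mem = λ v → ∃ λ a → v ≋ lincomb a b
    ; mem-resp = λ { u≋v (a , u≋ab) → a , ≋-trans (≋-sym u≋v) u≋ab }
    ; mem-0 = (λ _ → 0#) , ≋-sym (lincomb-0 b)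
    ; mem-+ = λ { (a , u≋ab) (a' , v≋a'b) →
        (λ j → a j + a' j) , ≋-trans (+ᵥ-cong u≋ab v≋a'b) (≋-sym (lincomb-+ a a' b)) }
    ; mem-· = λ { s (a , v≋ab) →
        (λ j → s * a j) , ≋-trans (·-cong refl v≋ab) (≋-sym (lincomb-* s a b)) }
    }

  _∩_ : ∀ {n} → Subspace n → Subspace n → Subspace n
  U ∩ W = record
    { mem = λ v → mem U v × mem W v
    ; mem-resp = λ { u≋v (u∈U , u∈W) → mem-resp U u≋v u∈U , mem-resp W u≋v u∈W }
    ; mem-0 = mem-0 U , mem-0 W
    ; mem-+ = λ { (u∈U , u∈W) (v∈U , v∈W) → mem-+ U u∈U v∈U , mem-+ W u∈W v∈W }
    ; mem-· = λ { a (v∈U , v∈W) → mem-· U a v∈U , mem-· W a v∈W }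
    }

  ⨁ : ∀ {n k} → (Fin k → Subspace n) → Subspace n
  ⨁ {n} {k} Y = record
    { mem = λ v → ∃ λ (w : Fin k → Vecᶠ n) → (∀ j → mem (Y j) (w j)) × (v ≋ sumᵥ w)
    ; mem-resp = λ { u≋v (w , w∈Y , u≋Σw) → w , w∈Y , ≋-trans (≋-sym u≋v) u≋Σw }
    ; mem-0 = (λ _ → 0ᵥ) , (λ j → mem-0 (Y j)) , ≋-sym (sumᵥ-0ᵥ {k = k} (λ _ → ≋-refl))
    ; mem-+ = λ { (w , w∈Y , u≋Σw) (w' , w'∈Y , v≋Σw') →
        (λ j → w j +ᵥ w' j) , (λ j → mem-+ (Y j) (w∈Y j) (w'∈Y j)) ,
        ≋-trans (+ᵥ-cong u≋Σw v≋Σw') (≋-sym (sumᵥ-+ᵥ w w')) }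
    ; mem-· = λ { a (w , w∈Y , v≋Σw) →
        (λ j → a · w j) , (λ j → mem-· (Y j) a (w∈Y j)) ,
        ≋-trans (·-cong refl v≋Σw) (IsLinear.sumᵥ-homo (·-linear a) w) }
    }

  mem-sumᵥ : ∀ {n k} (S : Subspace n) {w : Fin k → Vecᶠ n} →
    (∀ j → mem S (w j)) → mem S (sumᵥ w)
  mem-sumᵥ {k = zero} S _ = mem-0 S
  mem-sumᵥ {k = suc k} S w∈S = mem-+ S (w∈S fzero) (mem-sumᵥ S (w∈S ∘ fsuc))

  mem-lincomb : ∀ {n d} (S : Subspace n) (a : Fin d → Carrier) {b : Fin d → Vecᶠ n} →
    (∀ j → mem S (b j)) → mem S (lincomb a b)
  mem-lincomb S a b∈S = mem-sumᵥ S (λ j → mem-· S (a j) (b∈S j))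

  span-⊆ : ∀ {n d} {S : Subspace n} {b : Fin d → Vecᶠ n} → (∀ j → mem S (b j)) → span b ⊆ S
  span-⊆ {S = S} b∈S v (a , v≋ab) = mem-resp S (≋-sym v≋ab) (mem-lincomb S a b∈S)

  ⊆-⨁ : ∀ {n k} (Y : Fin k → Subspace n) j → Y j ⊆ ⨁ Y
  ⊆-⨁ Y j v v∈Yⱼ = updateAt (λ _ → 0ᵥ) j (const v) ,
    updateAt-elim (λ t u → mem (Y t) u) (λ _ → 0ᵥ) j v∈Yⱼ (λ t _ → mem-0 (Y t)) ,
    ≋-sym (sumᵥ-updateAt-0ᵥ j v)

  ⊆-refl : ∀ {n} (S : Subspace n) → S ⊆ S
  ⊆-refl _ _ v∈S = v∈S

  ⨁-⊆ : ∀ {n k} {Y : Fin k → Subspace n} {S : Subspace n} → (∀ j → Y j ⊆ S) → ⨁ Y ⊆ S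
  ⨁-⊆ {S = S} Y⊆S v (w , w∈Y , v≋Σw) =
    mem-resp S (≋-sym v≋Σw) (mem-sumᵥ S (λ j → Y⊆S j (w j) (w∈Y j)))

  module Basis {n d} (S : Subspace n) (S-dim : HasDim S d) where
    vectors : Fin d → Vecᶠ n
    vectors = proj₁ S-dim

    vectors∈ : ∀ i → mem S (vectors i)
    vectors∈ = proj₁ (proj₂ S-dim)

    independent : LinearlyIndependent vectors
    independent = proj₁ (proj₂ (proj₂ S-dim))

    spans : S ⊆ span vectors
    spans = proj₂ (proj₂ (proj₂ S-dim))

  record FinDimSubspace (n : ℕ) : Set (lsuc (c ⊔ ℓ)) where
    field
      space : Subspace n
      dim : ℕ
      hasDim : HasDim space dim

  Independent : ∀ {n k} → (Fin k → Subspace n) → Set (c ⊔ ℓ)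
  Independent {n} {k} W =
    ∀ (w : Fin k → Vecᶠ n) → (∀ j → mem (W j) (w j)) → sumᵥ w ≋ 0ᵥ → ∀ j → w j ≋ 0ᵥ

  IsDirectSum⇒Independent : ∀ {n k} {W : Fin k → Subspace n} → IsDirectSum W → Independent W
  IsDirectSum⇒Independent {k = k} {W} (_ , unique) w w∈W Σw≋0 =
    unique w (λ _ → 0ᵥ) w∈W (λ j → mem-0 (W j))
      (≋-trans Σw≋0 (≋-sym (sumᵥ-0ᵥ {k = k} (λ _ → ≋-refl))))

  concat-independent : ∀ {n k} {W : Fin k → Subspace n} {d : Fin k → ℕ}
    {b : (j : Fin k) → Fin (d j) → Vecᶠ n} →
    Independent W → (∀ j i → mem (W j) (b j i)) → (∀ j → LinearlyIndependent (b j)) →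
    LinearlyIndependent (concat b)
  concat-independent {W = W} {d} {b} W-independent b∈W b-independent a ab≋0 x
    with concatIndex-surjective d x
  ... | j , i , ≡.refl = b-independent j _ (W-independent _ pieces∈W Σpieces≋0 j) i
    where
    pieces∈W : ∀ j → mem (W j) (lincomb (λ i → a (concatIndex d j i)) (b j))
    pieces∈W j = mem-lincomb (W j) _ (b∈W j)
    Σpieces≋0 : sumᵥ (λ j → lincomb (λ i → a (concatIndex d j i)) (b j)) ≋ 0ᵥ
    Σpieces≋0 = ≋-trans (≋-sym (lincomb-concat a b)) ab≋0

  HasDim-⨁ : ∀ {n k} {W Y : Fin k → Subspace n} {e : Fin k → ℕ} → Independent W →
    (∀ j → Y j ⊆ W j) → (∀ j → HasDim (Y j) (e j)) → HasDim (⨁ Y) (sumℕ e)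
  HasDim-⨁ {n} {k} {W} {Y} {e} W-independent Y⊆W Y-dim =
    concat basis , concat-basis∈ ,
    concat-independent {W = W} W-independent (λ j i → Y⊆W j _ (Basis.vectors∈ (Y j) (Y-dim j) i))
                       (λ j → Basis.independent (Y j) (Y-dim j)) ,
    spans
    where
    basis : (j : Fin k) → Fin (e j) → Vecᶠ n
    basis j = Basis.vectors (Y j) (Y-dim j)

    concat-basis∈ : ∀ x → mem (⨁ Y) (concat basis x)
    concat-basis∈ x with concatIndex-surjective e x
    ... | j , i , ≡.refl = ≡.subst (mem (⨁ Y)) (≡.sym (concat-concatIndex basis j i))
                                   (⊆-⨁ Y j _ (Basis.vectors∈ (Y j) (Y-dim j) i))

    spans : ⨁ Y ⊆ span (concat basis)
    spans v (w , w∈Y , v≋Σw) = concat coords , (begin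
      v
        ≈⟨ v≋Σw ⟩
      sumᵥ w
        ≈⟨ sumᵥ-cong (λ j → proj₂ (coordinates j)) ⟩
      sumᵥ (λ j → lincomb (coords j) (basis j))
        ≈⟨ sumᵥ-cong (λ j → lincomb-cong (λ i → reflexive (≡.sym (concat-concatIndex coords j i)))
                                         (λ _ → ≋-refl)) ⟩
      sumᵥ (λ j → lincomb (λ i → concat coords (concatIndex e j i)) (basis j))
        ≈⟨ ≋-sym (lincomb-concat (concat coords) basis) ⟩
      lincomb (concat coords) (concat basis)
        ∎)
      where
      open ≋-Reasoning n
      coordinates : ∀ j → mem (span (basis j)) (w j)
      coordinates j = Basis.spans (Y j) (Y-dim j) (w j) (w∈Y j)
      coords : (j : Fin k) → Fin (e j) → Carrier
      coords j = proj₁ (coordinates j)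

  HasDim-whole : ∀ {n k} {W : Fin k → Subspace n} {d : Fin k → ℕ} → IsDirectSum W →
    (∀ j → HasDim (W j) (d j)) → HasDim (whole n) (sumℕ d)
  HasDim-whole {W = W} W-sum W-dim
    with HasDim-⨁ {W = W} {Y = W} (IsDirectSum⇒Independent {W = W} W-sum) (λ j → ⊆-refl (W j)) W-dim
  ... | b , _ , b-independent , b-spans =
    b , (λ _ → tt) , b-independent , λ v _ → b-spans v (proj₁ W-sum v)

module FiniteVectorSpace {c ℓ} (F : Field c ℓ) {q : ℕ} (F-card : HasCardinality F q) where
  open Field F
  open LinearAlgebra F
  open VectorSpace F
  open Enumeration setoid F-card

  _≈?_ : ∀ x y → Dec (x ≈ y)
  x ≈? y = map′ index-injective index-cong (index x FinP.≟ index y)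

  _≋?_ : ∀ {n} (u v : Vecᶠ n) → Dec (u ≋ v)
  u ≋? v = FinP.all? (λ i → u i ≈? v i)

  1<q : 1 < q
  1<q = FinP.injective⇒≤ {f = index ∘ bit} bit-injective
    where
    bit : Fin 2 → Carrier
    bit fzero = 0#
    bit (fsuc _) = 1#
    bit-injective : ∀ {x y} → index (bit x) ≡ index (bit y) → x ≡ y
    bit-injective {fzero} {fzero} _ = ≡.refl
    bit-injective {fzero} {fsuc fzero} eq = ⊥-elim (1≉0 (sym (index-injective eq)))
    bit-injective {fsuc fzero} {fzero} eq = ⊥-elim (1≉0 (index-injective eq))
    bit-injective {fsuc fzero} {fsuc fzero} _ = ≡.refl

  instance
    q-nonZero : NonZero q
    q-nonZero = ℕ.>-nonZero (ℕP.<-trans ℕP.0<1+n 1<q)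

  encode : ∀ {d} → Vecᶠ d → Fin (q ^ d)
  encode v = funToFin (index ∘ v)

  decode : ∀ {d} → Fin (q ^ d) → Vecᶠ d
  decode x = enum ∘ finToFun x

  decode-encode : ∀ {d} (v : Vecᶠ d) → decode (encode v) ≋ v
  decode-encode v i =
    trans (reflexive (≡.cong enum (FinP.finToFun-funToFin (index ∘ v) i))) (enum-index (v i))

  encode-injective : ∀ {d} {u v : Vecᶠ d} → encode u ≡ encode v → u ≋ v
  encode-injective {u = u} {v} eq i =
    trans (sym (decode-encode u i))
          (trans (reflexive (≡.cong (λ x → decode x i) eq)) (decode-encode v i))

  decode-injective : ∀ {d} {x y : Fin (q ^ d)} → decode {d} x ≋ decode {d} y → x ≡ y
  decode-injective {d} {x} {y} eq = begin
    x                                  ≡⟨ FinP.funToFin-finToFin {d} {q} x ⟨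
    funToFin (finToFun {q} {d} x)      ≡⟨ funToFin-cong (λ i → enum-injective _ _ (eq i)) ⟩
    funToFin (finToFun {q} {d} y)      ≡⟨ FinP.funToFin-finToFin {d} {q} y ⟩
    y                                  ∎
    where open ≡.≡-Reasoning

  injective⇒q^d≤ : ∀ {d M} (f : Vecᶠ d → Fin M) → (∀ {u v} → f u ≡ f v → u ≋ v) → q ^ d ≤ M
  injective⇒q^d≤ {d} f f-injective =
    FinP.injective⇒≤ {f = f ∘ decode {d}} (decode-injective {d} ∘ f-injective)

  injective⇒≤ : ∀ {d e} (f : Vecᶠ d → Vecᶠ e) → (∀ {u v} → f u ≋ f v → u ≋ v) → d ≤ e
  injective⇒≤ {d} {e} f f-injective =
    ^-cancelˡ-≤ q 1<q d e (injective⇒q^d≤ (encode ∘ f) (f-injective ∘ encode-injective))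

  search : ∀ {d p} {Q : Vecᶠ d → Set p} → (∀ {u v} → u ≋ v → Q u → Q v) →
    (∀ v → Dec (Q v)) → Dec (∃ Q)
  search Q-resp Q? = map′ (λ (x , Qx) → decode x , Qx)
                          (λ (v , Qv) → encode v , Q-resp (≋-sym (decode-encode v)) Qv)
                          (FinP.any? (Q? ∘ decode))

  mem-span? : ∀ {n d} (b : Fin d → Vecᶠ n) v → Dec (mem (span b) v)
  mem-span? b v = search (λ a≋a' v≋ab → ≋-trans v≋ab (lincomb-cong a≋a' (λ _ → ≋-refl)))
                         (λ a → v ≋? lincomb a b)

  mem? : ∀ {n d} (S : Subspace n) → HasDim S d → ∀ v → Dec (mem S v)
  mem? S S-dim v =
    map′ (span-⊆ {S = S} (Basis.vectors∈ S S-dim) v) (Basis.spans S S-dim v)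
         (mem-span? (Basis.vectors S S-dim) v)

  independent⇒≤ : ∀ {n d} {b : Fin d → Vecᶠ n} → LinearlyIndependent b → d ≤ n
  independent⇒≤ {b = b} b-independent =
    injective⇒≤ (λ a → lincomb a b) (lincomb-injective b-independent)

  independent⇒≤-spanning : ∀ {n d e} {b : Fin d → Vecᶠ n} (b' : Fin e → Vecᶠ n) →
    LinearlyIndependent b → (∀ i → mem (span b') (b i)) → d ≤ e
  independent⇒≤-spanning {n} {d} {e} {b} b' b-independent b∈span =
    injective⇒≤ coords coords-injective
    where
    combination∈span : ∀ a → mem (span b') (lincomb a b)
    combination∈span a = mem-lincomb (span b') a b∈span
    coords : Vecᶠ d → Vecᶠ e
    coords a = proj₁ (combination∈span a)
    coords-injective : ∀ {a a'} → coords a ≋ coords a' → a ≋ a'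
    coords-injective {a} {a'} eq = lincomb-injective b-independent (begin
      lincomb a b               ≈⟨ proj₂ (combination∈span a) ⟩
      lincomb (coords a) b'     ≈⟨ lincomb-cong eq (λ _ → ≋-refl) ⟩
      lincomb (coords a') b'    ≈⟨ ≋-sym (proj₂ (combination∈span a')) ⟩
      lincomb a' b              ∎)
      where open ≋-Reasoning n

  dim-mono : ∀ {n d e} (S T : Subspace n) → S ⊆ T → HasDim S d → HasDim T e → d ≤ e
  dim-mono S T S⊆T S-dim T-dim =
    independent⇒≤-spanning (Basis.vectors T T-dim) (Basis.independent S S-dim)
      (λ i → Basis.spans T T-dim _ (S⊆T _ (Basis.vectors∈ S S-dim i)))

  dim-unique : ∀ {n d e} (S : Subspace n) → HasDim S d → HasDim S e → d ≡ e
  dim-unique S S-dim S-dim' =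
    ℕP.≤-antisym (dim-mono S S (⊆-refl S) S-dim S-dim') (dim-mono S S (⊆-refl S) S-dim' S-dim)

  ∷-independent : ∀ {n d} {v : Vecᶠ n} {b : Fin d → Vecᶠ n} →
    LinearlyIndependent b → ¬ mem (span b) v → LinearlyIndependent (v ∷ b)
  ∷-independent {v = v} {b} b-independent v∉span a av+ab≋0 with a fzero ≈? 0#
  ... | yes a₀≈0 = λ { fzero → a₀≈0 ; (fsuc j) → b-independent (a ∘ fsuc) ab≋0 j }
    where
    ab≋0 : lincomb (a ∘ fsuc) b ≋ 0ᵥ
    ab≋0 i = trans (sym (+-identityˡ _))
                   (trans (+-congʳ (sym (trans (*-congʳ a₀≈0) (zeroˡ (v i))))) (av+ab≋0 i))
  ... | no a₀≉0 = ⊥-elim (v∉span ((λ j → - y * a (fsuc j)) ,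
                    ≋-trans (λ i → a*x+l≈0⇒x≈-y*l (av+ab≋0 i) y*a₀≈1)
                            (≋-sym (lincomb-* (- y) (a ∘ fsuc) b))))
    where
    y = proj₁ (inverse (a fzero) a₀≉0)
    y*a₀≈1 : y * a fzero ≈ 1#
    y*a₀≈1 = trans (*-comm y _) (proj₂ (inverse (a fzero) a₀≉0))

  HasDim-∃ : ∀ {n} (S : Subspace n) → (∀ v → Dec (mem S v)) → ∃ (HasDim S)
  HasDim-∃ {n} S S? =
    extend (suc n) (λ ()) (λ ()) (λ _ _ ())
      (≡.subst (n <_) (≡.sym (ℕP.+-identityʳ (suc n))) (ℕP.n<1+n n))
    where
    extend : ∀ fuel {d} (b : Fin d → Vecᶠ n) → (∀ i → mem S (b i)) → LinearlyIndependent b →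
      n < fuel ℕ.+ d → ∃ (HasDim S)
    extend zero b _ b-independent n<d = ⊥-elim (ℕP.<⇒≱ n<d (independent⇒≤ b-independent))
    extend (suc fuel) {d} b b∈S b-independent n<fuel+d
      with search {Q = λ v → mem S v × ¬ mem (span b) v}
             (λ u≋v (u∈S , u∉span) →
               mem-resp S u≋v u∈S , u∉span ∘ mem-resp (span b) (≋-sym u≋v))
             (λ v → S? v ×-dec ¬? (mem-span? b v))
    ... | yes (v , v∈S , v∉span) =
      extend fuel (v ∷ b) (λ { fzero → v∈S ; (fsuc i) → b∈S i })
             (∷-independent b-independent v∉span)
             (≡.subst (n <_) (≡.sym (ℕP.+-suc fuel d)) n<fuel+d)
    ... | no ∄v = d , b , b∈S , b-independent ,
                  λ v v∈S → decidable-stable (mem-span? b v)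
                                             (λ v∉span → ∄v (v , v∈S , v∉span))

  HasDim-∩ : ∀ {n d e} {U W : Subspace n} → HasDim U d → HasDim W e → ∃ (HasDim (U ∩ W))
  HasDim-∩ {U = U} {W} U-dim W-dim = HasDim-∃ (U ∩ W) (λ v → mem? U U-dim v ×-dec mem? W W-dim v)

module CoveringSubspaces {c ℓ g ℓg} (F : Field c ℓ) {q : ℕ} (F-card : HasCardinality F q)
  (G : Group g ℓg) {n : ℕ} (ρ : Representations.Representation F G n) where
  open LinearAlgebra F
  open Representations F G
  open VectorSpace F
  open FiniteVectorSpace F F-card

  act-linear : ∀ x → IsLinear (act ρ x)
  act-linear x = record { ≋-cong = act-cong ρ G.refl ; +ᵥ-homo = act-+ ρ x ; ·-homo = act-· ρ x }

  act-inverseʳ : ∀ x w → act ρ x (act ρ (x G.⁻¹) w) ≋ w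
  act-inverseʳ x w =
    ≋-trans (≋-sym (act-∙ ρ x (x G.⁻¹) w))
            (≋-trans (act-cong ρ (G.inverseʳ x) ≋-refl) (act-ε ρ w))

  act-inverseˡ : ∀ x w → act ρ (x G.⁻¹) (act ρ x w) ≋ w
  act-inverseˡ x w =
    ≋-trans (≋-sym (act-∙ ρ (x G.⁻¹) x w))
            (≋-trans (act-cong ρ (G.inverseˡ x) ≋-refl) (act-ε ρ w))

  invariant-preimage : ∀ {W : Subspace n} → Invariant ρ W →
    ∀ {x u w} → act ρ x u ≋ w → mem W w → mem W u
  invariant-preimage {W} W-invariant {x} {u} {w} xu≋w w∈W =
    mem-resp W (≋-trans (act-cong ρ G.refl (≋-sym xu≋w)) (act-inverseˡ x u))
               (W-invariant (x G.⁻¹) w w∈W)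

  covering-∩ : ∀ {U W : Subspace n} → Invariant ρ W → Covering ρ (whole n) U →
    Covering ρ W (U ∩ W)
  covering-∩ {U} {W} W-invariant (_ , U-covers) = (λ _ → proj₂) , cover
    where
    cover : ∀ w → mem W w → Σ G.Carrier λ x → Σ (Vecᶠ n) λ u → mem (U ∩ W) u × (act ρ x u ≋ w)
    cover w w∈W with U-covers w tt
    ... | x , u , u∈U , xu≋w = x , u , (u∈U , invariant-preimage {W} W-invariant xu≋w w∈W) , xu≋w

  q^codim≤order : ∀ {m dW dU} {W U : Subspace n} → HasOrder G m → Covering ρ W U →
    HasDim W dW → HasDim U dU → q ^ (dW ∸ dU) ≤ m
  q^codim≤order {m} {dW} {dU} {W} {U} G-order (_ , U-covers) W-dim U-dim =
    q^[a∸b]≤m q dW dU m 1≤m (injective⇒q^d≤ label label-injective)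
    where
    open Enumeration G.setoid G-order renaming (index to G-index; index-injective to G-index-injective)
    1≤m : 1 ≤ m
    1≤m = ℕ.>-nonZero⁻¹ m {{FinP.nonZeroIndex (G-index G.ε)}}
    bW = Basis.vectors W W-dim
    bU = Basis.vectors U U-dim
    cover : (a : Vecᶠ dW) →
      Σ G.Carrier λ x → Σ (Vecᶠ n) λ u → mem U u × (act ρ x u ≋ lincomb a bW)
    cover a = U-covers _ (mem-lincomb W a (Basis.vectors∈ W W-dim))
    element : Vecᶠ dW → G.Carrier
    element a = proj₁ (cover a)
    preimage : Vecᶠ dW → Vecᶠ n
    preimage a = proj₁ (proj₂ (cover a))
    moves : ∀ a → act ρ (element a) (preimage a) ≋ lincomb a bW
    moves a = proj₂ (proj₂ (proj₂ (cover a)))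
    coordinates : ∀ a → mem (span bU) (preimage a)
    coordinates a = Basis.spans U U-dim _ (proj₁ (proj₂ (proj₂ (cover a))))
    coords : Vecᶠ dW → Vecᶠ dU
    coords a = proj₁ (coordinates a)
    label : Vecᶠ dW → Fin (m ℕ.* q ^ dU)
    label a = combine (G-index (element a)) (encode (coords a))
    label-injective : ∀ {a a'} → label a ≡ label a' → a ≋ a'
    label-injective {a} {a'} eq = lincomb-injective (Basis.independent W W-dim) (begin
      lincomb a bW                          ≈⟨ ≋-sym (moves a) ⟩
      act ρ (element a) (preimage a)        ≈⟨ act-cong ρ same-element same-preimage ⟩
      act ρ (element a') (preimage a')      ≈⟨ moves a' ⟩
      lincomb a' bW                         ∎)
      where
      open ≋-Reasoning n
      same-indices = FinP.combine-injective _ _ _ _ eq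
      same-element : element a G.≈ element a'
      same-element = G-index-injective (proj₁ same-indices)
      same-preimage : preimage a ≋ preimage a'
      same-preimage = begin
        preimage a                 ≈⟨ proj₂ (coordinates a) ⟩
        lincomb (coords a) bU      ≈⟨ lincomb-cong (encode-injective {dU} (proj₂ same-indices))
                                                   (λ _ → ≋-refl) ⟩
        lincomb (coords a') bU     ≈⟨ ≋-sym (proj₂ (coordinates a')) ⟩
        preimage a'                ∎

  q^h≤order : ∀ {m h} (W : Subspace n) → HasOrder G m → IsH ρ W h → q ^ h ≤ m
  q^h≤order {m} W G-order ((U , U-covering , dW , dU , W-dim , U-dim , h≡dW∸dU) , _) =
    ≡.subst (λ e → q ^ e ≤ m) (≡.sym h≡dW∸dU)
      (q^codim≤order {W = W} {U} G-order U-covering W-dim U-dim)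

  IsH⇒HasDim : ∀ (W : Subspace n) {h} → IsH ρ W h → ∃ (HasDim W)
  IsH⇒HasDim _ ((_ , _ , dW , _ , W-dim , _) , _) = dW , W-dim

  ⨁-covers : ∀ {k} {W Y : Fin k → Subspace n} → IsDirectSum W →
    (∀ w → (∀ j → mem (W j) (w j)) →
      Σ G.Carrier λ x → ∀ j → Σ (Vecᶠ n) λ u → mem (Y j) u × (act ρ x u ≋ w j)) →
    Covering ρ (whole n) (⨁ Y)
  ⨁-covers {k} {W} {Y} (decompose , _) move-into-Y = (λ _ _ → tt) , cover
    where
    cover : ∀ v → _ → Σ G.Carrier λ x → Σ (Vecᶠ n) λ u → mem (⨁ Y) u × (act ρ x u ≋ v)
    cover v _ with decompose v
    ... | w , w∈W , v≋Σw with move-into-Y w w∈W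
    ...   | x , moved = x , sumᵥ u , (u , (λ j → proj₁ (proj₂ (moved j))) , ≋-refl) , (begin
      act ρ x (sumᵥ u)           ≈⟨ IsLinear.sumᵥ-homo (act-linear x) u ⟩
      sumᵥ (λ j → act ρ x (u j)) ≈⟨ sumᵥ-cong (λ j → proj₂ (proj₂ (moved j))) ⟩
      sumᵥ w                     ≈⟨ ≋-sym v≋Σw ⟩
      v                          ∎)
      where
      open ≋-Reasoning n
      u : Fin k → Vecᶠ n
      u j = proj₁ (moved j)

  covering-from-summand : ∀ {k} (W : Fin k → Subspace n) {dW : Fin k → ℕ} →
    (∀ j → Invariant ρ (W j)) → IsDirectSum W → (∀ j → HasDim (W j) (dW j)) →
    ∀ i {U dU} → Covering ρ (W i) U → HasDim U dU →
    Σ (Subspace n) λ U' → CoveringOfCodim ρ (whole n) U' (dW i ∸ dU)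
  covering-from-summand {k} W {dW} W-invariant W-sum W-dim i {U} {dU} (U⊆Wᵢ , U-covers) U-dim =
    ⨁ Y ,
    ⨁-covers {W = W} {Y} W-sum move-into-Y ,
    sumℕ dW , sumℕ e ,
    HasDim-whole {W = W} W-sum W-dim ,
    HasDim-⨁ {W = W} {Y} (IsDirectSum⇒Independent {W = W} W-sum) Y⊆W (hasDim ∘ pieces) ,
    ≡.sym (sumℕ-∸-updateAt dim summands i replacement)
    where
    open FinDimSubspace
    summands : Fin k → FinDimSubspace n
    summands j = record { space = W j ; dim = dW j ; hasDim = W-dim j }
    replacement : FinDimSubspace n
    replacement = record { space = U ; dim = dU ; hasDim = U-dim }
    pieces : Fin k → FinDimSubspace n
    pieces = updateAt summands i (const replacement)
    Y : Fin k → Subspace n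
    Y = space ∘ pieces
    e : Fin k → ℕ
    e = dim ∘ pieces
    Y⊆W : ∀ j → Y j ⊆ W j
    Y⊆W = updateAt-elim (λ j p → space p ⊆ W j) summands i U⊆Wᵢ (λ j _ → ⊆-refl (W j))
    move-into-Y : ∀ w → (∀ j → mem (W j) (w j)) →
      Σ G.Carrier λ x → ∀ j → Σ (Vecᶠ n) λ u → mem (Y j) u × (act ρ x u ≋ w j)
    move-into-Y w w∈W with U-covers (w i) (w∈W i)
    ... | x , u , u∈U , xu≋wᵢ = x , updateAt-elim
      (λ j p → Σ (Vecᶠ n) λ u → mem (space p) u × (act ρ x u ≋ w j)) summands i
      (u , u∈U , xu≋wᵢ)
      (λ j _ → act ρ (x G.⁻¹) (w j) , W-invariant j (x G.⁻¹) (w j) (w∈W j) ,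
               act-inverseʳ x (w j))

  h-summand≤h-whole : ∀ {k} (W : Fin k → Subspace n) {dW : Fin k → ℕ} {hV} {h : Fin k → ℕ} →
    (∀ j → Invariant ρ (W j)) → IsDirectSum W → (∀ j → HasDim (W j) (dW j)) →
    IsH ρ (whole n) hV → (∀ j → IsH ρ (W j) (h j)) → ∀ i → h i ≤ hV
  h-summand≤h-whole W {dW} {hV} {h} W-invariant W-sum W-dim (_ , hV-maximal) W-h i
    with proj₁ (W-h i)
  ... | U , U-covering , dWᵢ , dU , Wᵢ-dim , U-dim , hᵢ≡dWᵢ∸dU
    with covering-from-summand W W-invariant W-sum W-dim i {U} U-covering U-dim
  ...   | U' , U'-covering =
    hV-maximal U' (h i) (≡.subst (CoveringOfCodim ρ (whole n) U') dWᵢ∸dU≡hᵢ U'-covering)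
    where
    dWᵢ∸dU≡hᵢ : dW i ∸ dU ≡ h i
    dWᵢ∸dU≡hᵢ = ≡.sym (≡.trans hᵢ≡dWᵢ∸dU (≡.cong (_∸ dU) (dim-unique (W i) Wᵢ-dim (W-dim i))))

  h-whole≤sum-h : ∀ {k} (W : Fin k → Subspace n) {dW : Fin k → ℕ} {hV} {h : Fin k → ℕ} →
    (∀ j → Invariant ρ (W j)) → IsDirectSum W → (∀ j → HasDim (W j) (dW j)) →
    IsH ρ (whole n) hV → (∀ j → IsH ρ (W j) (h j)) → hV ≤ sumℕ h
  h-whole≤sum-h {k} W {dW} {hV} {h} W-invariant W-sum W-dim
    ((U , U-covering , dV , dU , V-dim , U-dim , hV≡dV∸dU) , _) W-h =
    begin
      hV                         ≡⟨ hV≡dV∸dU ⟩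
      dV ∸ dU                    ≤⟨ ℕP.∸-mono dV≤ΣdW Σe≤dU ⟩
      sumℕ dW ∸ sumℕ e           ≤⟨ sumℕ-∸ dW e ⟩
      sumℕ (λ j → dW j ∸ e j)    ≤⟨ sumℕ-mono codim≤h ⟩
      sumℕ h                     ∎
    where
    open ℕP.≤-Reasoning
    X : Fin k → Subspace n
    X j = U ∩ W j
    X-dim : ∀ j → ∃ (HasDim (X j))
    X-dim j = HasDim-∩ {U = U} {W = W j} U-dim (W-dim j)
    e : Fin k → ℕ
    e j = proj₁ (X-dim j)
    codim≤h : ∀ j → dW j ∸ e j ≤ h j
    codim≤h j = proj₂ (W-h j) (X j) (dW j ∸ e j)
      (covering-∩ {U} {W j} (W-invariant j) U-covering ,
       dW j , e j , W-dim j , proj₂ (X-dim j) , ≡.refl)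
    dV≤ΣdW : dV ≤ sumℕ dW
    dV≤ΣdW = dim-mono (whole n) (whole n) (⊆-refl (whole n)) V-dim (HasDim-whole {W = W} W-sum W-dim)
    Σe≤dU : sumℕ e ≤ dU
    Σe≤dU = dim-mono (⨁ X) U (⨁-⊆ {Y = X} {U} (λ _ _ → proj₁))
      (HasDim-⨁ {W = W} {Y = X} (IsDirectSum⇒Independent {W = W} W-sum) (λ _ _ → proj₂)
                                  (proj₂ ∘ X-dim))
      U-dim

corollary4p3 : ∀ {c ℓ g ℓg} (F : Field c ℓ) (q : ℕ) → IsPrimePower q → HasCardinality F q →
    (G : Group g ℓg) (m : ℕ) → HasOrder G m → Coprime m q →
    (n : ℕ) (ρ : Representations.Representation F G n) →
    (k : ℕ) (W : Fin k → LinearAlgebra.Subspace F n) →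
    (∀ i → Representations.Invariant F G ρ (W i)) →
    LinearAlgebra.IsDirectSum F W →
    (hV : ℕ) (h : Fin k → ℕ) →
    Representations.IsH F G ρ (LinearAlgebra.whole F n) hV →
    (∀ i → Representations.IsH F G ρ (W i) (h i)) →
    (∀ i → h i ≤ hV) × (hV ≤ sumℕ h) × (q ^ hV ≤ m)
corollary4p3 F q _ F-card G m G-order _ n ρ k W W-invariant W-sum hV h V-h W-h =
  h-summand≤h-whole W W-invariant W-sum W-dim V-h W-h ,
  h-whole≤sum-h W W-invariant W-sum W-dim V-h W-h ,
  q^h≤order (LinearAlgebra.whole F n) G-order V-h
  where
  open CoveringSubspaces F {q} F-card G ρ
  W-dim : ∀ j → LinearAlgebra.HasDim F (W j) (proj₁ (IsH⇒HasDim (W j) (W-h j)))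
  W-dim j = proj₂ (IsH⇒HasDim (W j) (W-h j))
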